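{- Let $G$ be a non-trivial finite group and $m>1$. The complement $\overline{\mathscr{B}}_m$ of the graph of intervals $\mathscr{B}_m$ is isomorphic to the Kneser graph $KG_{m+1,2}$.
   Context: For a finite group $G$ with identity $e$, $G^\times=G\setminus\{e\}$. For $x\in G^\times$ and $1\leqslant k<l\leqslant m+1$, $\mathbf{x}_{[k,l)}\in G^m$ has $j$-th coordinate $x$ for $k\leqslant j<l$ and $e$ otherwise; the interval $\mathcal{S}_{[k,l)}=\{\mathbf{x}_{[k,l)}:x\in G^\times\}$; $\mathcal{S}$ is the union of all intervals, and $\mathscr{G}_m(G)=Cay(G^m,\mathcal{S})$ is the graph on $G^m$ with $\mathbf{g}\sim\mathbf{h}$ iff $\mathbf{h}\mathbf{g}^{ -1}\in\mathcal{S}$. $\mathscr{B}_m$ is the graph whose vertices are the intervals $\mathcal{S}_{[k,l)}$, $1\leqslant k<l\leqslant m+1$, where two distinct intervals $\mathcal{S}_{[k,l)}$ and $\mathcal{S}_{[i,j)}$ are adjacent iff some $\mathbf{x}_{[k,l)}\in\mathcal{S}_{[k,l)}$ and some $\mathbf{y}_{[i,j)}\in\mathcal{S}_{[i,j)}$ are adjacent in $\mathscr{G}_m(G)$. The Kneser graph $KG_{m+1,2}$ has as vertices the $2$-element subsets of $\{1,\dots,m+1\}$, two being adjacent iff they are disjoint. -}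

module Defs where

open import Level using (_⊔_)
open import Algebra.Bundles using (Group)
open import Data.Nat as ℕ using (ℕ; suc; _≤ᵇ_; _<ᵇ_)
open import Data.Fin as Fin using (Fin; toℕ)
open import Data.Bool using (if_then_else_; _∧_)
open import Data.Product using (Σ; ∃; _×_; _,_; proj₁; proj₂)
open import Relation.Nullary using (¬_)
open import Relation.Binary.PropositionalEquality using (_≡_; _≢_)
open import Function.Bundles using (_↔_; _⇔_; Inverse)

GraphIso : ∀ {a b r s} (V : Set a) (W : Set b)
           (AdjV : V → V → Set r) (AdjW : W → W → Set s) → Set _
GraphIso V W AdjV AdjW =
  Σ (V ↔ W) λ f → ∀ u v → AdjV u v ⇔ AdjW (Inverse.to f u) (Inverse.to f v)

-- Index conventions (0-based): coordinates of G^m are j : Fin m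
-- (paper's j+1); an interval [k,l) with 1 ≤ k < l ≤ m+1 in the paper
-- is encoded by k' = k-1, l' = l-1 in Fin (suc m), with k' < l'.
-- Coordinate j lies in the interval iff k' ≤ j < l'.

IntervalIndex : ℕ → Set
IntervalIndex m = Σ (Fin (suc m) × Fin (suc m)) λ p → proj₁ p Fin.< proj₂ p

-- Kneser graph KG_{m+1,2}: vertices are the 2-subsets {a,b} of an
-- (m+1)-element set, encoded as pairs a < b in Fin (suc m);
-- adjacent iff the two subsets are disjoint.
KneserVertex : ℕ → Set
KneserVertex m = Σ (Fin (suc m) × Fin (suc m)) λ p → proj₁ p Fin.< proj₂ p

KneserAdj : ∀ m → KneserVertex m → KneserVertex m → Set
KneserAdj m ((a , b) , _) ((c , d) , _) =
  a ≢ c × a ≢ d × b ≢ c × b ≢ d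

module _ {c ℓ} (G : Group c ℓ) where
  open Group G

  IsFinite : Set (c ⊔ ℓ)
  IsFinite = Σ ℕ λ n → Σ (Fin n → Carrier) λ enum →
    (∀ x → ∃ λ i → enum i ≈ x) × (∀ i j → enum i ≈ enum j → i ≡ j)

  NonTrivial : Set (c ⊔ ℓ)
  NonTrivial = ∃ λ x → ¬ (x ≈ ε)

  Tuple : ℕ → Set c
  Tuple m = Fin m → Carrier

  intervalVec : ∀ {m} → Fin (suc m) → Fin (suc m) → Carrier → Tuple m
  intervalVec k l x j =
    if (toℕ k ≤ᵇ toℕ j) ∧ (toℕ j <ᵇ toℕ l) then x else ε

  InS : ∀ {m} → Tuple m → Set (c ⊔ ℓ)
  InS {m} v = Σ (IntervalIndex m) λ I → ∃ λ x → ¬ (x ≈ ε) ×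
    (∀ j → v j ≈ intervalVec (proj₁ (proj₁ I)) (proj₂ (proj₁ I)) x j)

  CayAdj : ∀ {m} → Tuple m → Tuple m → Set (c ⊔ ℓ)
  CayAdj g h = InS (λ j → h j ∙ (g j) ⁻¹)

  elemOf : ∀ {m} → IntervalIndex m → Carrier → Tuple m
  elemOf ((k , l) , _) x = intervalVec k l x

  BAdj : ∀ m → IntervalIndex m → IntervalIndex m → Set (c ⊔ ℓ)
  BAdj m I J = I ≢ J × (∃ λ x → ¬ (x ≈ ε) × ∃ λ y → ¬ (y ≈ ε) ×
    CayAdj (elemOf I x) (elemOf J y))

  BbarAdj : ∀ m → IntervalIndex m → IntervalIndex m → Set (c ⊔ ℓ)
  BbarAdj m I J = I ≢ J × ¬ BAdj m I J

-- Pad an element of G^m with e on both sides and say that it jumps at the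
-- boundary n ∈ {0,…,m} when its coordinates n-1 and n differ.  A
-- non-identity interval element x_{[k,l)} jumps exactly at k and l.  If the
-- 2-sets {a,b} and {c,d} are disjoint, then at each of a, b, c exactly one
-- of x_{[a,b)}, y_{[c,d)} jumps, so y_{[c,d)} x_{[a,b)}⁻¹ jumps at three
-- points and is no interval element.  If the two intervals share an
-- endpoint, the quotient of suitable g_{[a,b)}, g^{±1}_{[c,d)} is a
-- non-identity element on the interval between the two remaining endpoints.
-- Hence the identity on the encoding {k,l} of [k,l) is the isomorphism.
module Submission where

open import Defs
open import Algebra.Bundles using (Group)
import Algebra.Properties.Group as GroupProperties
open import Data.Bool using (Bool; true; false; if_then_else_; _∧_)
open import Data.Bool.Properties using (∧-zeroʳ)
open import Data.Empty using (⊥; ⊥-elim)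
open import Data.Fin using (Fin; toℕ; fromℕ<)
open import Data.Fin.Properties using (toℕ-injective; toℕ-fromℕ<; toℕ≤pred[n])
open import Data.Nat using (ℕ; zero; suc; _≤_; _<_; _≤ᵇ_; _<ᵇ_; s≤s; _≟_; _<?_)
open import Data.Nat.Properties
  using ( ≤-refl; ≤-trans; <-trans; <-≤-trans; <⇒≤; <⇒≢; <⇒≱; ≤⇒≯; ≮⇒≥
        ; <-cmp; <-irrelevant; _≤?_)
open import Data.Product using (_,_; proj₁; proj₂)
open import Data.Sum using (_⊎_; inj₁; inj₂)
open import Function using (_∘_)
open import Function.Bundles using (mk⇔)
open import Function.Construct.Identity using (↔-id)
open import Relation.Binary.Definitions using (tri<; tri≈; tri>)
open import Relation.Binary.PropositionalEquality
  using (_≡_; _≢_; refl; sym; cong; cong₂; subst)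
open import Relation.Nullary using (¬_; yes; no)
open import Relation.Nullary.Decidable using (dec-true; dec-false)

≤ᵇ-true : ∀ {m n} → m ≤ n → (m ≤ᵇ n) ≡ true
≤ᵇ-true {m} {n} = dec-true (m ≤? n)

≤ᵇ-false : ∀ {m n} → n < m → (m ≤ᵇ n) ≡ false
≤ᵇ-false {m} {n} n<m = dec-false (m ≤? n) (<⇒≱ n<m)

<ᵇ-true : ∀ {m n} → m < n → (m <ᵇ n) ≡ true
<ᵇ-true = ≤ᵇ-true

<ᵇ-false : ∀ {m n} → n ≤ m → (m <ᵇ n) ≡ false
<ᵇ-false {m} {n} n≤m = dec-false (suc m ≤? n) (≤⇒≯ n≤m)

<ᵇ-suc : ∀ m n → m ≢ n → (m <ᵇ suc n) ≡ (m <ᵇ n)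
<ᵇ-suc zero    zero    0≢0 = ⊥-elim (0≢0 refl)
<ᵇ-suc zero    (suc n) _   = refl
<ᵇ-suc (suc m) zero    _   = refl
<ᵇ-suc (suc m) (suc n) m≢n = <ᵇ-suc m n (m≢n ∘ cong suc)

≤ᵇ-suc : ∀ m n → m ≢ suc n → (m ≤ᵇ suc n) ≡ (m ≤ᵇ n)
≤ᵇ-suc zero    n _   = refl
≤ᵇ-suc (suc m) n m≢n = <ᵇ-suc m n (m≢n ∘ cong suc)

<ᵇ-sucˡ : ∀ m n → suc m ≢ n → (suc m <ᵇ n) ≡ (m <ᵇ n)
<ᵇ-sucˡ m zero    _   = refl
<ᵇ-sucˡ m (suc n) m≢n = sym (<ᵇ-suc m n (m≢n ∘ cong suc))

inside : ℕ → ℕ → ℕ → Bool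
inside k l n = (k ≤ᵇ n) ∧ (n <ᵇ l)

inside-true : ∀ {k l n} → k ≤ n → n < l → inside k l n ≡ true
inside-true k≤n n<l = cong₂ _∧_ (≤ᵇ-true k≤n) (<ᵇ-true n<l)

inside-below : ∀ {k l n} → n < k → inside k l n ≡ false
inside-below n<k = cong (_∧ _) (≤ᵇ-false n<k)

inside-above : ∀ {k l n} → l ≤ n → inside k l n ≡ false
inside-above {k} {l} {n} l≤n =
  subst (λ b → (k ≤ᵇ n) ∧ b ≡ false) (sym (<ᵇ-false l≤n)) (∧-zeroʳ (k ≤ᵇ n))

inside-suc : ∀ k l n → suc n ≢ k → suc n ≢ l → inside k l (suc n) ≡ inside k l n
inside-suc k l n n≢k n≢l = cong₂ _∧_ (≤ᵇ-suc k n (n≢k ∘ sym)) (<ᵇ-sucˡ n l n≢l)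

data Region : Bool → Bool → Bool → Set where
  outside : Region false false false
  left    : Region true false true
  right   : Region false true true

region : ∀ {a b d} → a ≤ b → b ≤ d → ∀ n → Region (inside a b n) (inside b d n) (inside a d n)
region {a} {b} {d} a≤b b≤d n with n <? a | n <? b | n <? d
... | yes n<a | _ | _
  rewrite inside-below {l = b} n<a | inside-below {l = d} (<-≤-trans n<a a≤b)
        | inside-below {l = d} n<a = outside
... | no n≮a | yes n<b | _
  rewrite inside-true (≮⇒≥ n≮a) n<b | inside-below {l = d} n<b
        | inside-true (≮⇒≥ n≮a) (<-≤-trans n<b b≤d) = left
... | no n≮a | no n≮b | yes n<d
  rewrite inside-above {a} (≮⇒≥ n≮b) | inside-true (≮⇒≥ n≮b) n<d
        | inside-true (≮⇒≥ n≮a) n<d = right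
... | no _ | no _ | no n≮d
  rewrite inside-above {a} (≤-trans b≤d (≮⇒≥ n≮d)) | inside-above {b} (≮⇒≥ n≮d)
        | inside-above {a} (≮⇒≥ n≮d) = outside

no-three-in-pair : ∀ {A : Set} {a b c p q : A} → a ≢ b → a ≢ c → b ≢ c →
  a ≡ p ⊎ a ≡ q → b ≡ p ⊎ b ≡ q → c ≡ p ⊎ c ≡ q → ⊥
no-three-in-pair a≢b _   _   (inj₁ refl) (inj₁ refl) _           = a≢b refl
no-three-in-pair _   a≢c _   (inj₁ refl) (inj₂ refl) (inj₁ refl) = a≢c refl
no-three-in-pair _   _   b≢c (inj₁ refl) (inj₂ refl) (inj₂ refl) = b≢c refl
no-three-in-pair _   _   b≢c (inj₂ refl) (inj₁ refl) (inj₁ refl) = b≢c refl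
no-three-in-pair _   a≢c _   (inj₂ refl) (inj₁ refl) (inj₂ refl) = a≢c refl
no-three-in-pair a≢b _   _   (inj₂ refl) (inj₂ refl) _           = a≢b refl

start end : ∀ {m} → IntervalIndex m → Fin (suc m)
start = proj₁ ∘ proj₁
end   = proj₂ ∘ proj₁

interval-≡ : ∀ {m} {I J : IntervalIndex m} → start I ≡ start J → end I ≡ end J → I ≡ J
interval-≡ {I = _ , p} {J = _ , q} refl refl = cong (_ ,_) (<-irrelevant p q)

module _ {c ℓ} (G : Group c ℓ) where
  open Group G renaming (refl to ≈-refl; sym to ≈-sym)
  open GroupProperties G

  -- intervalVec G k l z j unfolds to indicator (toℕ k) (toℕ l) z (toℕ j); on ℕ
  -- the tuple is padded with ε, so the boundary after the last coordinate exists.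
  indicator : ℕ → ℕ → Carrier → ℕ → Carrier
  indicator k l z n = if inside k l n then z else ε

  indicator-in : ∀ {k l n} z → k ≤ n → n < l → indicator k l z n ≡ z
  indicator-in z k≤n n<l = cong (if_then z else ε) (inside-true k≤n n<l)

  indicator-below : ∀ {k l n} z → n < k → indicator k l z n ≡ ε
  indicator-below {l = l} z n<k = cong (if_then z else ε) (inside-below {l = l} n<k)

  indicator-above : ∀ {k l n} z → l ≤ n → indicator k l z n ≡ ε
  indicator-above {k} z l≤n = cong (if_then z else ε) (inside-above {k} l≤n)

  indicator-⁻¹ : ∀ k l z n → indicator k l z n ⁻¹ ≈ indicator k l (z ⁻¹) n
  indicator-⁻¹ k l z n with inside k l n
  ... | true  = ≈-refl
  ... | false = ε⁻¹≈ε

  ⁻¹-nonidentity : ∀ {z} → ¬ z ≈ ε → ¬ z ⁻¹ ≈ ε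
  ⁻¹-nonidentity z≉ε z⁻¹≈ε = z≉ε (⁻¹-injective (trans z⁻¹≈ε (≈-sym ε⁻¹≈ε)))

  //-identityʳ : ∀ x → x // ε ≈ x
  //-identityʳ x = trans (∙-congˡ ε⁻¹≈ε) (identityʳ x)

  ε//ε : ε // ε ≈ ε
  ε//ε = inverseʳ ε

  previous : (ℕ → Carrier) → ℕ → Carrier
  previous f zero    = ε
  previous f (suc n) = f n

  JumpsAt : (ℕ → Carrier) → ℕ → Set ℓ
  JumpsAt f n = ¬ previous f n ≈ f n

  jumps-cong : ∀ {f g} → (∀ n → f n ≈ g n) → ∀ n → JumpsAt f n → JumpsAt g n
  jumps-cong f≈g zero    f-jumps e = f-jumps (trans e (≈-sym (f≈g zero)))
  jumps-cong f≈g (suc n) f-jumps e = f-jumps (trans (f≈g n) (trans e (≈-sym (f≈g (suc n)))))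

  previous-// : ∀ f g n → previous (λ i → f i // g i) n ≈ previous f n // previous g n
  previous-// f g zero    = ≈-sym ε//ε
  previous-// f g (suc n) = ≈-refl

  //-jumpsˡ : ∀ f g n → JumpsAt f n → previous g n ≈ g n → JumpsAt (λ i → f i // g i) n
  //-jumpsˡ f g n f-jumps g-steady e = f-jumps (∙-cancelʳ (g n ⁻¹) _ _
    (trans (∙-congˡ (⁻¹-cong (≈-sym g-steady))) (trans (≈-sym (previous-// f g n)) e)))

  //-jumpsʳ : ∀ f g n → previous f n ≈ f n → JumpsAt g n → JumpsAt (λ i → f i // g i) n
  //-jumpsʳ f g n f-steady g-jumps e = g-jumps (⁻¹-injective (∙-cancelˡ (f n) _ _
    (trans (∙-congʳ (≈-sym f-steady)) (trans (≈-sym (previous-// f g n)) e))))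

  indicator-steady : ∀ {k l} z n → n ≢ k → n ≢ l → previous (indicator k l z) n ≡ indicator k l z n
  indicator-steady {zero}  z zero    0≢0 _   = ⊥-elim (0≢0 refl)
  indicator-steady {suc k} z zero    _   _   = refl
  indicator-steady {k} {l} z (suc n) n≢k n≢l =
    cong (if_then z else ε) (sym (inside-suc k l n n≢k n≢l))

  indicator-jump⇒endpoint : ∀ {k l} z n → JumpsAt (indicator k l z) n → n ≡ k ⊎ n ≡ l
  indicator-jump⇒endpoint {k} {l} z n jumps with n ≟ k | n ≟ l
  ... | yes n≡k | _       = inj₁ n≡k
  ... | no _    | yes n≡l = inj₂ n≡l
  ... | no n≢k  | no n≢l  = ⊥-elim (jumps (reflexive (indicator-steady z n n≢k n≢l)))

  indicator-jumps-at-start : ∀ {k l z} → k < l → ¬ z ≈ ε → JumpsAt (indicator k l z) k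
  indicator-jumps-at-start {k} {l} {z} k<l z≉ε e =
    z≉ε (trans (reflexive (sym (indicator-in z ≤-refl k<l)))
               (trans (≈-sym e) (reflexive (before-start k))))
    where
    before-start : ∀ k → previous (indicator k l z) k ≡ ε
    before-start zero    = refl
    before-start (suc k) = indicator-below {l = l} z ≤-refl

  indicator-jumps-at-end : ∀ {k l z} → k < l → ¬ z ≈ ε → JumpsAt (indicator k l z) l
  indicator-jumps-at-end {k} {z = z} (s≤s k≤l) z≉ε e =
    z≉ε (trans (reflexive (sym (indicator-in z k≤l ≤-refl)))
               (trans e (reflexive (indicator-above {k} z ≤-refl))))

  disjoint-quotient-not-interval : ∀ {a b c d p q x y z} → a < b → c < d →
    a ≢ c → a ≢ d → b ≢ c → b ≢ d → ¬ x ≈ ε → ¬ y ≈ ε →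
    ¬ (∀ n → indicator c d y n // indicator a b x n ≈ indicator p q z n)
  disjoint-quotient-not-interval {a} {b} {c} {d} {p} {q} {x} {y} {z}
                                 a<b c<d a≢c a≢d b≢c b≢d x≉ε y≉ε H =
    no-three-in-pair (<⇒≢ a<b) a≢c b≢c
      (endpoint a (//-jumpsʳ Y X a (steady y a a≢c a≢d) (indicator-jumps-at-start a<b x≉ε)))
      (endpoint b (//-jumpsʳ Y X b (steady y b b≢c b≢d) (indicator-jumps-at-end a<b x≉ε)))
      (endpoint c (//-jumpsˡ Y X c (indicator-jumps-at-start c<d y≉ε)
                                   (steady x c (a≢c ∘ sym) (b≢c ∘ sym))))
    where
    Y X : ℕ → Carrier
    Y = indicator c d y
    X = indicator a b x
    steady : ∀ {k l} w n → n ≢ k → n ≢ l → previous (indicator k l w) n ≈ indicator k l w n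
    steady w n n≢k n≢l = reflexive (indicator-steady w n n≢k n≢l)
    endpoint : ∀ n → JumpsAt (λ i → Y i // X i) n → n ≡ p ⊎ n ≡ q
    endpoint n jumps = indicator-jump⇒endpoint z n (jumps-cong H n jumps)

  indicator-//-prefix : ∀ {a b d} → a ≤ b → b ≤ d → ∀ g n →
    indicator a d g n // indicator a b g n ≈ indicator b d g n
  indicator-//-prefix {a} {b} {d} a≤b b≤d g n
    with inside a b n | inside b d n | inside a d n | region a≤b b≤d n
  ... | _ | _ | _ | outside = ε//ε
  ... | _ | _ | _ | left    = inverseʳ g
  ... | _ | _ | _ | right   = //-identityʳ g

  indicator-//-suffix : ∀ {a b d} → a ≤ b → b ≤ d → ∀ g n →
    indicator a d g n // indicator b d g n ≈ indicator a b g n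
  indicator-//-suffix {a} {b} {d} a≤b b≤d g n
    with inside a b n | inside b d n | inside a d n | region a≤b b≤d n
  ... | _ | _ | _ | outside = ε//ε
  ... | _ | _ | _ | left    = //-identityʳ g
  ... | _ | _ | _ | right   = inverseʳ g

  indicator-//-concat : ∀ {a b d} → a ≤ b → b ≤ d → ∀ g n →
    indicator b d g n // indicator a b (g ⁻¹) n ≈ indicator a d g n
  indicator-//-concat {a} {b} {d} a≤b b≤d g n
    with inside a b n | inside b d n | inside a d n | region a≤b b≤d n
  ... | _ | _ | _ | outside = ε//ε
  ... | _ | _ | _ | left    = trans (identityˡ _) (⁻¹-involutive g)
  ... | _ | _ | _ | right   = //-identityʳ g

  extend-beyond : ∀ {m} (f g : ℕ → Carrier) → (∀ (j : Fin m) → f (toℕ j) ≈ g (toℕ j)) →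
    (∀ n → m ≤ n → f n ≈ g n) → ∀ n → f n ≈ g n
  extend-beyond {m} f g on-Fin beyond n with n <? m
  ... | yes n<m = subst (λ i → f i ≈ g i) (toℕ-fromℕ< n<m) (on-Fin (fromℕ< n<m))
  ... | no n≮m  = beyond n (≮⇒≥ n≮m)

  indicatorOf : ∀ {m} → IntervalIndex m → Carrier → ℕ → Carrier
  indicatorOf I = indicator (toℕ (start I)) (toℕ (end I))

  indicatorOf-beyond : ∀ {m n} (I : IntervalIndex m) w → m ≤ n → indicatorOf I w n ≡ ε
  indicatorOf-beyond I w m≤n =
    indicator-above {toℕ (start I)} w (≤-trans (toℕ≤pred[n] (end I)) m≤n)

  quotient-on-ℕ : ∀ {m} (I J K : IntervalIndex m) {x y z} →
    (∀ j → elemOf G J y j // elemOf G I x j ≈ elemOf G K z j) →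
    ∀ n → indicatorOf J y n // indicatorOf I x n ≈ indicatorOf K z n
  quotient-on-ℕ I J K {x} {y} {z} H = extend-beyond _ _ H λ n m≤n →
    trans (reflexive (cong₂ _//_ (indicatorOf-beyond J y m≤n) (indicatorOf-beyond I x m≤n)))
          (trans ε//ε (reflexive (sym (indicatorOf-beyond K z m≤n))))

  CayAdj-sym : ∀ {m} {u v : Tuple G m} → CayAdj G u v → CayAdj G v u
  CayAdj-sym {u = u} {v} (K@((p , q) , _) , z , z≉ε , H) =
    K , z ⁻¹ , ⁻¹-nonidentity z≉ε , λ j →
      trans (≈-sym (⁻¹-anti-homo-// (v j) (u j)))
            (trans (⁻¹-cong (H j)) (indicator-⁻¹ (toℕ p) (toℕ q) z (toℕ j)))

  BAdj-sym : ∀ {m} {I J : IntervalIndex m} → BAdj G m I J → BAdj G m J I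
  BAdj-sym (I≢J , x , x≉ε , y , y≉ε , adj) = I≢J ∘ sym , y , y≉ε , x , x≉ε , CayAdj-sym adj

  disjoint⇒nonadjacent : ∀ {m} (I J : IntervalIndex m) → KneserAdj m I J → BbarAdj G m I J
  disjoint⇒nonadjacent I@(_ , a<b) J@(_ , c<d) (a≢c , a≢d , b≢c , b≢d) =
    (a≢c ∘ cong start) , λ where
      (_ , x , x≉ε , y , y≉ε , K , z , _ , H) →
        disjoint-quotient-not-interval {p = toℕ (start K)} {toℕ (end K)} a<b c<d
          (a≢c ∘ toℕ-injective) (a≢d ∘ toℕ-injective)
          (b≢c ∘ toℕ-injective) (b≢d ∘ toℕ-injective)
          x≉ε y≉ε (quotient-on-ℕ I J K H)

  adjacent-via : ∀ {m} (I J K : IntervalIndex m) {x y z} →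
    I ≢ J → ¬ x ≈ ε → ¬ y ≈ ε → ¬ z ≈ ε →
    (∀ n → indicatorOf J y n // indicatorOf I x n ≈ indicatorOf K z n) → BAdj G m I J
  adjacent-via I J K {x} {y} {z} I≢J x≉ε y≉ε z≉ε H =
    I≢J , x , x≉ε , y , y≉ε , K , z , z≉ε , H ∘ toℕ

  module _ {m : ℕ} {g : Carrier} (g≉ε : ¬ g ≈ ε) where

    sameStart-adjacent : (I J : IntervalIndex m) → I ≢ J → start I ≡ start J → BAdj G m I J
    sameStart-adjacent ((a , b) , a<b) ((a , d) , a<d) I≢J refl
      with <-cmp (toℕ b) (toℕ d)
    ... | tri< b<d _ _ = adjacent-via _ _ ((b , d) , b<d) I≢J g≉ε g≉ε g≉ε
                           (indicator-//-prefix (<⇒≤ a<b) (<⇒≤ b<d) g)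
    ... | tri≈ _ b≡d _ = ⊥-elim (I≢J (interval-≡ refl (toℕ-injective b≡d)))
    ... | tri> _ _ d<b = BAdj-sym (adjacent-via _ _ ((d , b) , d<b) (I≢J ∘ sym)
                           g≉ε g≉ε g≉ε (indicator-//-prefix (<⇒≤ a<d) (<⇒≤ d<b) g))

    sameEnd-adjacent : (I J : IntervalIndex m) → I ≢ J → end I ≡ end J → BAdj G m I J
    sameEnd-adjacent ((a , b) , a<b) ((c , b) , c<b) I≢J refl
      with <-cmp (toℕ a) (toℕ c)
    ... | tri< a<c _ _ = BAdj-sym (adjacent-via _ _ ((a , c) , a<c) (I≢J ∘ sym)
                           g≉ε g≉ε g≉ε (indicator-//-suffix (<⇒≤ a<c) (<⇒≤ c<b) g))
    ... | tri≈ _ a≡c _ = ⊥-elim (I≢J (interval-≡ (toℕ-injective a≡c) refl))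
    ... | tri> _ _ c<a = adjacent-via _ _ ((c , a) , c<a) I≢J g≉ε g≉ε g≉ε
                           (indicator-//-suffix (<⇒≤ c<a) (<⇒≤ a<b) g)

    consecutive-adjacent : (I J : IntervalIndex m) → I ≢ J → end I ≡ start J → BAdj G m I J
    consecutive-adjacent ((a , b) , a<b) ((b , d) , b<d) I≢J refl =
      adjacent-via _ _ ((a , d) , <-trans a<b b<d) I≢J (⁻¹-nonidentity g≉ε) g≉ε g≉ε
        (indicator-//-concat (<⇒≤ a<b) (<⇒≤ b<d) g)

    nonadjacent⇒disjoint : ∀ I J → BbarAdj G m I J → KneserAdj m I J
    nonadjacent⇒disjoint I J (I≢J , ¬adj) =
        (λ a≡c → ¬adj (sameStart-adjacent I J I≢J a≡c))
      , (λ a≡d → ¬adj (BAdj-sym (consecutive-adjacent J I (I≢J ∘ sym) (sym a≡d))))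
      , (λ b≡c → ¬adj (consecutive-adjacent I J I≢J b≡c))
      , (λ b≡d → ¬adj (sameEnd-adjacent I J I≢J b≡d))

proposition4p4 : ∀ {c ℓ} (G : Group c ℓ) → IsFinite G → NonTrivial G →
    (m : ℕ) → 1 < m →
    GraphIso (IntervalIndex m) (KneserVertex m) (BbarAdj G m) (KneserAdj m)
proposition4p4 G _ (g , g≉ε) m _ =
  ↔-id _ , λ I J → mk⇔ (nonadjacent⇒disjoint G g≉ε I J) (disjoint⇒nonadjacent G I J)
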